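{- Let $p:\binom{[n]}{2}\to\mathbb{R}$ be a tropical Plücker vector and $d\ge 0$. Then the function $\tau^d(p)$ on $\binom{[n]}{d}$ defined by $\tau^d(p)_I=\sum_{i,j\in I,\ i<j}p_{\{i,j\}}$ is a tropical Plücker vector.
   Context: A function $p:\binom{[n]}{k}\to\mathbb{R}$ is a tropical Plücker vector if for every $S\in\binom{[n]}{k-2}$ and distinct $i,j,a,b\in[n]\setminus S$, the minimum of $p_{S\cup\{i,j\}}+p_{S\cup\{a,b\}}$, $p_{S\cup\{i,a\}}+p_{S\cup\{j,b\}}$, $p_{S\cup\{i,b\}}+p_{S\cup\{j,a\}}$ is attained at least twice. (For $k=2$, $S=\emptyset$.) -}

module Defs where

open import Level using (0ℓ)
open import Data.Nat using (ℕ; zero; suc)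
open import Data.Bool using (Bool; true; false; if_then_else_; _∧_)
open import Data.Fin using (Fin; zero; suc; _<_)
open import Data.Fin.Properties using (_<?_)
open import Data.Fin.Subset using (Subset; ⁅_⁆; _∪_; _∉_; ∣_∣)
open import Data.Vec using (lookup)
open import Data.Product using (_×_)
open import Data.Sum using (_⊎_)
open import Relation.Nullary using (¬_)
open import Relation.Nullary.Decidable using (⌊_⌋)
open import Relation.Binary.PropositionalEquality using (_≡_)
open import Relation.Binary.Structures using (IsTotalOrder)
open import Algebra.Structures using (IsAbelianGroup)

-- A linearly ordered abelian group (ℝ with + and ≤ is an instance).
record OrderedAbelianGroup : Set₁ where
  infixl 6 _+_
  infix 4 _≤_
  field
    Carrier        : Set
    _+_            : Carrier → Carrier → Carrier
    0#             : Carrier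
    -_             : Carrier → Carrier
    _≤_            : Carrier → Carrier → Set
    isAbelianGroup : IsAbelianGroup _≡_ _+_ 0# -_
    isTotalOrder   : IsTotalOrder _≡_ _≤_
    +-monoˡ-≤      : ∀ {a b} c → a ≤ b → a + c ≤ b + c

module _ (G : OrderedAbelianGroup) where
  open OrderedAbelianGroup G

  MinAttainedTwice : Carrier → Carrier → Carrier → Set
  MinAttainedTwice x y z =
    (x ≡ y × x ≤ z) ⊎ (x ≡ z × x ≤ y) ⊎ (y ≡ z × y ≤ x)

  pair : {n : ℕ} → Fin n → Fin n → Subset n
  pair i j = ⁅ i ⁆ ∪ ⁅ j ⁆

  -- p : binom([n],k) → G, encoded as a function on all subsets of Fin n
  -- of which only the values on k-subsets are used.
  IsTropicalPlucker : (n k : ℕ) → (Subset n → Carrier) → Set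
  IsTropicalPlucker n k p =
    (S : Subset n) → ∣ S ∣ Data.Nat.+ 2 ≡ k →
    (i j a b : Fin n) →
    i ∉ S → j ∉ S → a ∉ S → b ∉ S →
    ¬ i ≡ j → ¬ i ≡ a → ¬ i ≡ b → ¬ j ≡ a → ¬ j ≡ b → ¬ a ≡ b →
    MinAttainedTwice
      (p (S ∪ pair i j) + p (S ∪ pair a b))
      (p (S ∪ pair i a) + p (S ∪ pair j b))
      (p (S ∪ pair i b) + p (S ∪ pair j a))

  sumFin : (n : ℕ) → (Fin n → Carrier) → Carrier
  sumFin zero    f = 0#
  sumFin (suc n) f = f zero + sumFin n (λ i → f (suc i))

  tau : {n : ℕ} → (Subset n → Carrier) → Subset n → Carrier
  tau {n} p I =
    sumFin n (λ i → sumFin n (λ j →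
      if lookup I i ∧ lookup I j ∧ ⌊ i <? j ⌋ then p (pair i j) else 0#))

-- Write ω(x, y) = p{x,y} for x < y and 0 otherwise, and for subsets A, B let
-- C(A, B) = Σ_{x ∈ A, y ∈ B} ω(x, y); then τ(p)_I = C(I, I), and C is additive
-- in each argument over disjoint unions.  Expanding C at I = S ∪ {i, j} with
-- i, j ∉ S gives τ(p)_{S ∪ {i,j}} = τ(p)_S + ℓ(i) + ℓ(j) + p{i,j}, where
-- ℓ(x) = C(S, {x}) + C({x}, S).  Hence each of the three sums in the exchange
-- relation for τ(p) is the corresponding sum for p translated by the common
-- amount 2 τ(p)_S + ℓ(i) + ℓ(j) + ℓ(a) + ℓ(b), and translation preserves the
-- property that the minimum is attained twice.
module Submission where

open import Defs
open import Level using (0ℓ)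
open import Data.Nat as Nat using (ℕ; zero; suc)
open import Data.Bool using (Bool; true; false; if_then_else_; _∧_; _∨_)
open import Data.Fin using (Fin; zero; suc)
open import Data.Fin.Properties using (_<?_; <-cmp; <-irrefl)
open import Data.Fin.Subset using (Subset; ⁅_⁆; _∪_; _∩_; _∉_; ⊥; Empty)
open import Data.Fin.Subset.Properties
  using (∪-comm; ∪-identityˡ; ∣⊥∣≡0; ∉⊥; Empty-unique; x∈⁅y⁆⇒x≡y; x≢y⇒x∉⁅y⁆; x∈p∩q⁻; x∈p∩q⁺; x∈p∪q⁻)
open import Data.Vec using (lookup)
open import Data.Vec.Properties using (lookup-zipWith; lookup-replicate)
open import Data.Product using (_,_)
open import Data.Sum using (inj₁; inj₂)
open import Function using (_∘_)
open import Relation.Nullary using (¬_; contradiction)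
open import Relation.Nullary.Decidable using (⌊_⌋; dec-yes-recompute; dec-no)
open import Relation.Binary using (tri<; tri≈; tri>)
open import Relation.Binary.PropositionalEquality
open import Algebra.Bundles using (CommutativeMonoid)
open import Algebra.Structures using (IsAbelianGroup)
import Algebra.Properties.CommutativeMonoid.Sum as MonoidSum
import Algebra.Properties.CommutativeSemigroup as CommutativeSemigroupProperties
import Algebra.Solver.CommutativeMonoid as CommutativeMonoidSolver

Empty-∩⇒∧≡false : ∀ {n} {A B : Subset n} → Empty (A ∩ B) → ∀ x → lookup A x ∧ lookup B x ≡ false
Empty-∩⇒∧≡false {A = A} {B} empty x = begin
  lookup A x ∧ lookup B x ≡⟨ lookup-zipWith _∧_ x A B ⟨
  lookup (A ∩ B) x        ≡⟨ cong (λ C → lookup C x) (Empty-unique empty) ⟩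
  lookup ⊥ x              ≡⟨ lookup-replicate x false ⟩
  false ∎
  where open ≡-Reasoning

∉⇒Empty-∩⁅⁆ : ∀ {n} {A : Subset n} {x} → x ∉ A → Empty (A ∩ ⁅ x ⁆)
∉⇒Empty-∩⁅⁆ {A = A} x∉A (y , y∈A∩⁅x⁆) with x∈p∩q⁻ A _ y∈A∩⁅x⁆
... | y∈A , y∈⁅x⁆ rewrite x∈⁅y⁆⇒x≡y _ y∈⁅x⁆ = x∉A y∈A

Empty-∩-∪ : ∀ {n} {A B C : Subset n} → Empty (A ∩ B) → Empty (A ∩ C) → Empty (A ∩ (B ∪ C))
Empty-∩-∪ {A = A} {B} {C} emptyB emptyC (x , x∈A∩B∪C) with x∈p∩q⁻ A _ x∈A∩B∪C
... | x∈A , x∈B∪C with x∈p∪q⁻ B C x∈B∪C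
...   | inj₁ x∈B = emptyB (x , x∈p∩q⁺ (x∈A , x∈B))
...   | inj₂ x∈C = emptyC (x , x∈p∩q⁺ (x∈A , x∈C))

⁅x⁆∩⁅y⁆-Empty : ∀ {n} {x y : Fin n} → ¬ x ≡ y → Empty (⁅ x ⁆ ∩ ⁅ y ⁆)
⁅x⁆∩⁅y⁆-Empty x≢y = ∉⇒Empty-∩⁅⁆ (x≢y⇒x∉⁅y⁆ (x≢y ∘ sym))

module _ (G : OrderedAbelianGroup) where
  open OrderedAbelianGroup G
  open IsAbelianGroup isAbelianGroup using (isCommutativeMonoid; identityˡ; identityʳ; comm)

  +-commutativeMonoid : CommutativeMonoid 0ℓ 0ℓ
  +-commutativeMonoid = record { isCommutativeMonoid = isCommutativeMonoid }

  open MonoidSum +-commutativeMonoid using (sum; sum-syntax; sum-cong-≗; sum-replicate-zero; ∑-distrib-+)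
  open CommutativeSemigroupProperties (CommutativeMonoid.commutativeSemigroup +-commutativeMonoid)
    using (interchange)
  open CommutativeMonoidSolver +-commutativeMonoid using (solve; _⊜_; _⊕_)

  +-monoʳ-≤ : ∀ c {a b} → a ≤ b → c + a ≤ c + b
  +-monoʳ-≤ c {a} {b} a≤b = subst₂ _≤_ (comm a c) (comm b c) (+-monoˡ-≤ c a≤b)

  MinAttainedTwice-translate : ∀ w {x y z} → MinAttainedTwice G x y z →
    MinAttainedTwice G (w + x) (w + y) (w + z)
  MinAttainedTwice-translate w (inj₁ (x≡y , x≤z)) = inj₁ (cong (w +_) x≡y , +-monoʳ-≤ w x≤z)
  MinAttainedTwice-translate w (inj₂ (inj₁ (x≡z , x≤y))) = inj₂ (inj₁ (cong (w +_) x≡z , +-monoʳ-≤ w x≤y))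
  MinAttainedTwice-translate w (inj₂ (inj₂ (y≡z , y≤x))) = inj₂ (inj₂ (cong (w +_) y≡z , +-monoʳ-≤ w y≤x))

  MinAttainedTwice-cong : ∀ {x y z x′ y′ z′} → x ≡ x′ → y ≡ y′ → z ≡ z′ →
    MinAttainedTwice G x y z → MinAttainedTwice G x′ y′ z′
  MinAttainedTwice-cong refl refl refl m = m

  sumFin≗sum : ∀ n (f : Fin n → Carrier) → sumFin G n f ≡ sum f
  sumFin≗sum zero    f = refl
  sumFin≗sum (suc n) f = cong (f zero +_) (sumFin≗sum n (f ∘ suc))

  restrict : Bool → Carrier → Carrier
  restrict b v = if b then v else 0#

  restrict-∧ : ∀ a b v → restrict (a ∧ b) v ≡ restrict a (restrict b v)
  restrict-∧ true  b v = refl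
  restrict-∧ false b v = refl

  restrict-∨ : ∀ {a b} v → a ∧ b ≡ false → restrict (a ∨ b) v ≡ restrict a v + restrict b v
  restrict-∨ {true}  {true}  v ()
  restrict-∨ {true}  {false} v _ = sym (identityʳ v)
  restrict-∨ {false} {b}     v _ = sym (identityˡ (restrict b v))

  restrict-+ : ∀ a u v → restrict a (u + v) ≡ restrict a u + restrict a v
  restrict-+ true  u v = refl
  restrict-+ false u v = sym (identityˡ 0#)

  sum-restrict : ∀ {n} a (f : Fin n → Carrier) → ∑[ x < n ] restrict a (f x) ≡ restrict a (sum f)
  sum-restrict {n} true  f = refl
  sum-restrict {n} false f = sum-replicate-zero n

  sum-restrict-⁅⁆ : ∀ {n} (x : Fin n) (f : Fin n → Carrier) → ∑[ z < n ] restrict (lookup ⁅ x ⁆ z) (f z) ≡ f x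
  sum-restrict-⁅⁆ {suc n} zero f = begin
    f zero + ∑[ z < n ] restrict (lookup ⊥ z) (f (suc z))
      ≡⟨ cong (f zero +_) (sum-cong-≗ λ z → cong (λ b → restrict b (f (suc z))) (lookup-replicate z false)) ⟩
    f zero + ∑[ z < n ] 0#   ≡⟨ cong (f zero +_) (sum-replicate-zero n) ⟩
    f zero + 0#              ≡⟨ identityʳ (f zero) ⟩
    f zero ∎
    where open ≡-Reasoning
  sum-restrict-⁅⁆ {suc n} (suc x) f = trans (identityˡ _) (sum-restrict-⁅⁆ x (f ∘ suc))

  module _ {n : ℕ} where

    crossSum : (Fin n → Fin n → Carrier) → Subset n → Subset n → Carrier
    crossSum f A B = ∑[ x < n ] restrict (lookup A x) (∑[ y < n ] restrict (lookup B y) (f x y))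

    crossSum-∪ˡ : ∀ f {A B} C → Empty (A ∩ B) → crossSum f (A ∪ B) C ≡ crossSum f A C + crossSum f B C
    crossSum-∪ˡ f {A} {B} C empty = begin
      crossSum f (A ∪ B) C
        ≡⟨ sum-cong-≗ (λ x → trans (cong (λ b → restrict b (row x)) (lookup-zipWith _∨_ x A B))
                                   (restrict-∨ (row x) (Empty-∩⇒∧≡false empty x))) ⟩
      ∑[ x < n ] (restrict (lookup A x) (row x) + restrict (lookup B x) (row x))
        ≡⟨ ∑-distrib-+ (λ x → restrict (lookup A x) (row x)) (λ x → restrict (lookup B x) (row x)) ⟩
      crossSum f A C + crossSum f B C ∎
      where
      open ≡-Reasoning
      row : Fin n → Carrier
      row x = ∑[ y < n ] restrict (lookup C y) (f x y)

    crossSum-∪ʳ : ∀ f A {B C} → Empty (B ∩ C) → crossSum f A (B ∪ C) ≡ crossSum f A B + crossSum f A C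
    crossSum-∪ʳ f A {B} {C} empty = begin
      crossSum f A (B ∪ C)
        ≡⟨ sum-cong-≗ (λ x → cong (restrict (lookup A x)) (trans (sum-cong-≗ (split x)) (∑-distrib-+ (term B x) (term C x)))) ⟩
      ∑[ x < n ] restrict (lookup A x) (row B x + row C x) ≡⟨ sum-cong-≗ (λ x → restrict-+ (lookup A x) _ _) ⟩
      ∑[ x < n ] (restrict (lookup A x) (row B x) + restrict (lookup A x) (row C x))
        ≡⟨ ∑-distrib-+ (λ x → restrict (lookup A x) (row B x)) (λ x → restrict (lookup A x) (row C x)) ⟩
      crossSum f A B + crossSum f A C ∎
      where
      open ≡-Reasoning
      term : Subset n → Fin n → Fin n → Carrier
      term D x y = restrict (lookup D y) (f x y)
      row : Subset n → Fin n → Carrier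
      row D x = sum (term D x)
      split : ∀ x y → term (B ∪ C) x y ≡ term B x y + term C x y
      split x y = trans (cong (λ b → restrict b (f x y)) (lookup-zipWith _∨_ y B C))
                        (restrict-∨ (f x y) (Empty-∩⇒∧≡false empty y))

    crossSum-∪-∪ : ∀ f {A B} → Empty (A ∩ B) →
      crossSum f (A ∪ B) (A ∪ B) ≡ (crossSum f A A + crossSum f B B) + (crossSum f A B + crossSum f B A)
    crossSum-∪-∪ f {A} {B} empty = begin
      crossSum f (A ∪ B) (A ∪ B)                                          ≡⟨ crossSum-∪ˡ f (A ∪ B) empty ⟩
      crossSum f A (A ∪ B) + crossSum f B (A ∪ B)
        ≡⟨ cong₂ _+_ (crossSum-∪ʳ f A empty) (crossSum-∪ʳ f B empty) ⟩
      (crossSum f A A + crossSum f A B) + (crossSum f B A + crossSum f B B)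
        ≡⟨ solve 4 (λ aa ab ba bb → (aa ⊕ ab) ⊕ (ba ⊕ bb) ⊜ (aa ⊕ bb) ⊕ (ab ⊕ ba)) refl _ _ _ _ ⟩
      (crossSum f A A + crossSum f B B) + (crossSum f A B + crossSum f B A) ∎
      where open ≡-Reasoning

    crossSum-⁅⁆ : ∀ f x y → crossSum f ⁅ x ⁆ ⁅ y ⁆ ≡ f x y
    crossSum-⁅⁆ f x y = trans (sum-restrict-⁅⁆ x _) (sum-restrict-⁅⁆ y (f x))

  module _ {n : ℕ} (p : Subset n → Carrier) where

    ω : Fin n → Fin n → Carrier
    ω x y = restrict ⌊ x <? y ⌋ (p (pair G x y))

    tau≡crossSum : ∀ I → tau G p I ≡ crossSum ω I I
    tau≡crossSum I = begin
      tau G p I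
        ≡⟨ sumFin≗sum n (λ x → sumFin G n (entry x)) ⟩
      ∑[ x < n ] sumFin G n (entry x)
        ≡⟨ sum-cong-≗ (λ x → trans (sumFin≗sum n (entry x)) (sum-cong-≗ (split x))) ⟩
      ∑[ x < n ] ∑[ y < n ] restrict (lookup I x) (restrict (lookup I y) (ω x y))
        ≡⟨ sum-cong-≗ (λ x → sum-restrict (lookup I x) (λ y → restrict (lookup I y) (ω x y))) ⟩
      crossSum ω I I ∎
      where
      open ≡-Reasoning
      entry : Fin n → Fin n → Carrier
      entry x y = restrict (lookup I x ∧ lookup I y ∧ ⌊ x <? y ⌋) (p (pair G x y))
      split : ∀ x y → entry x y ≡ restrict (lookup I x) (restrict (lookup I y) (ω x y))
      split x y = trans (restrict-∧ (lookup I x) _ _) (cong (restrict (lookup I x)) (restrict-∧ (lookup I y) _ _))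

    ω-diag : ∀ x → ω x x ≡ 0#
    ω-diag x rewrite dec-no (x <? x) (<-irrefl refl) = refl

    ω-sym-sum : ∀ {x y} → ¬ x ≡ y → ω x y + ω y x ≡ p (pair G x y)
    ω-sym-sum {x} {y} x≢y with <-cmp x y
    ... | tri< x<y _ y≮x rewrite dec-yes-recompute (x <? y) x<y | dec-no (y <? x) y≮x = identityʳ _
    ... | tri≈ _ x≡y _ = contradiction x≡y x≢y
    ... | tri> x≮y _ y<x rewrite dec-no (x <? y) x≮y | dec-yes-recompute (y <? x) y<x =
      trans (identityˡ _) (cong p (∪-comm ⁅ y ⁆ ⁅ x ⁆))

    crossSum-pair : ∀ {x y} → ¬ x ≡ y → crossSum ω (pair G x y) (pair G x y) ≡ p (pair G x y)
    crossSum-pair {x} {y} x≢y = begin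
      crossSum ω (pair G x y) (pair G x y)                     ≡⟨ crossSum-∪-∪ ω (⁅x⁆∩⁅y⁆-Empty x≢y) ⟩
      (crossSum ω ⁅ x ⁆ ⁅ x ⁆ + crossSum ω ⁅ y ⁆ ⁅ y ⁆) + (crossSum ω ⁅ x ⁆ ⁅ y ⁆ + crossSum ω ⁅ y ⁆ ⁅ x ⁆)
        ≡⟨ cong₂ _+_ (cong₂ _+_ (crossSum-⁅⁆ ω x x) (crossSum-⁅⁆ ω y y))
                     (cong₂ _+_ (crossSum-⁅⁆ ω x y) (crossSum-⁅⁆ ω y x)) ⟩
      (ω x x + ω y y) + (ω x y + ω y x)                        ≡⟨ cong₂ _+_ (cong₂ _+_ (ω-diag x) (ω-diag y)) (ω-sym-sum x≢y) ⟩
      (0# + 0#) + p (pair G x y)                               ≡⟨ cong (_+ p (pair G x y)) (identityˡ 0#) ⟩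
      0# + p (pair G x y)                                      ≡⟨ identityˡ _ ⟩
      p (pair G x y) ∎
      where open ≡-Reasoning

    link : Subset n → Fin n → Carrier
    link S x = crossSum ω S ⁅ x ⁆ + crossSum ω ⁅ x ⁆ S

    tau-∪-pair : ∀ {S x y} → x ∉ S → y ∉ S → ¬ x ≡ y →
      tau G p (S ∪ pair G x y) ≡ (tau G p S + p (pair G x y)) + (link S x + link S y)
    tau-∪-pair {S} {x} {y} x∉S y∉S x≢y = begin
      tau G p (S ∪ pair G x y)                        ≡⟨ tau≡crossSum (S ∪ pair G x y) ⟩
      crossSum ω (S ∪ pair G x y) (S ∪ pair G x y)    ≡⟨ crossSum-∪-∪ ω (Empty-∩-∪ (∉⇒Empty-∩⁅⁆ x∉S) (∉⇒Empty-∩⁅⁆ y∉S)) ⟩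
      (crossSum ω S S + crossSum ω (pair G x y) (pair G x y)) + (crossSum ω S (pair G x y) + crossSum ω (pair G x y) S)
        ≡⟨ cong₂ _+_ (cong₂ _+_ (sym (tau≡crossSum S)) (crossSum-pair x≢y))
                     (cong₂ _+_ (crossSum-∪ʳ ω S (⁅x⁆∩⁅y⁆-Empty x≢y)) (crossSum-∪ˡ ω S (⁅x⁆∩⁅y⁆-Empty x≢y))) ⟩
      (tau G p S + p (pair G x y)) + ((crossSum ω S ⁅ x ⁆ + crossSum ω S ⁅ y ⁆) + (crossSum ω ⁅ x ⁆ S + crossSum ω ⁅ y ⁆ S))
        ≡⟨ cong ((tau G p S + p (pair G x y)) +_) (interchange _ _ _ _) ⟩
      (tau G p S + p (pair G x y)) + (link S x + link S y) ∎
      where open ≡-Reasoning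

    tau-∪-pair-+ : ∀ {S x y z t} → x ∉ S → y ∉ S → z ∉ S → t ∉ S → ¬ x ≡ y → ¬ z ≡ t →
      tau G p (S ∪ pair G x y) + tau G p (S ∪ pair G z t)
        ≡ ((tau G p S + tau G p S) + ((link S x + link S y) + (link S z + link S t))) + (p (pair G x y) + p (pair G z t))
    tau-∪-pair-+ x∉S y∉S z∉S t∉S x≢y z≢t =
      trans (cong₂ _+_ (tau-∪-pair x∉S y∉S x≢y) (tau-∪-pair z∉S t∉S z≢t))
            (solve 5 (λ τ u v ℓ ℓ′ → ((τ ⊕ u) ⊕ ℓ) ⊕ ((τ ⊕ v) ⊕ ℓ′) ⊜ ((τ ⊕ τ) ⊕ (ℓ ⊕ ℓ′)) ⊕ (u ⊕ v)) refl _ _ _ _ _)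

    IsTropicalPlucker-pairs : IsTropicalPlucker G n 2 p → ∀ {i j a b} →
      ¬ i ≡ j → ¬ i ≡ a → ¬ i ≡ b → ¬ j ≡ a → ¬ j ≡ b → ¬ a ≡ b →
      MinAttainedTwice G (p (pair G i j) + p (pair G a b)) (p (pair G i a) + p (pair G j b))
                         (p (pair G i b) + p (pair G j a))
    IsTropicalPlucker-pairs plucker {i} {j} {a} {b} i≢j i≢a i≢b j≢a j≢b a≢b =
      MinAttainedTwice-cong (cong₂ _+_ (p-⊥∪ i j) (p-⊥∪ a b)) (cong₂ _+_ (p-⊥∪ i a) (p-⊥∪ j b))
        (cong₂ _+_ (p-⊥∪ i b) (p-⊥∪ j a))
        (plucker ⊥ (cong (Nat._+ 2) (∣⊥∣≡0 n)) i j a b ∉⊥ ∉⊥ ∉⊥ ∉⊥ i≢j i≢a i≢b j≢a j≢b a≢b)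
      where
      p-⊥∪ : ∀ x y → p (⊥ ∪ pair G x y) ≡ p (pair G x y)
      p-⊥∪ x y = cong p (∪-identityˡ (pair G x y))

mainTheorem19 : (G : OrderedAbelianGroup) (n : ℕ)
    (p : Subset n → OrderedAbelianGroup.Carrier G) →
    IsTropicalPlucker G n 2 p →
    (d : ℕ) → IsTropicalPlucker G n d (tau G p)
mainTheorem19 G n p plucker d S _ i j a b i∉S j∉S a∉S b∉S i≢j i≢a i≢b j≢a j≢b a≢b =
  MinAttainedTwice-cong G (sym sum-ij-ab) (sym sum-ia-jb) (sym sum-ib-ja)
    (MinAttainedTwice-translate G w (IsTropicalPlucker-pairs G p plucker i≢j i≢a i≢b j≢a j≢b a≢b))
  where
  open OrderedAbelianGroup G using (Carrier; _+_)
  open IsAbelianGroup (OrderedAbelianGroup.isAbelianGroup G) using (comm)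
  open CommutativeSemigroupProperties (CommutativeMonoid.commutativeSemigroup (+-commutativeMonoid G))
    using (interchange)
  ℓ : Fin n → Carrier
  ℓ = link G p S
  doubleTau : Carrier
  doubleTau = tau G p S + tau G p S
  w : Carrier
  w = doubleTau + ((ℓ i + ℓ j) + (ℓ a + ℓ b))
  regroup-links : ∀ {ℓs ℓs′} q → ℓs ≡ ℓs′ → (doubleTau + ℓs) + q ≡ (doubleTau + ℓs′) + q
  regroup-links q = cong (λ ℓs → (doubleTau + ℓs) + q)
  sum-ij-ab : tau G p (S ∪ pair G i j) + tau G p (S ∪ pair G a b) ≡ w + (p (pair G i j) + p (pair G a b))
  sum-ij-ab = tau-∪-pair-+ G p i∉S j∉S a∉S b∉S i≢j a≢b
  sum-ia-jb : tau G p (S ∪ pair G i a) + tau G p (S ∪ pair G j b) ≡ w + (p (pair G i a) + p (pair G j b))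
  sum-ia-jb = trans (tau-∪-pair-+ G p i∉S a∉S j∉S b∉S i≢a j≢b) (regroup-links _ (interchange (ℓ i) (ℓ a) (ℓ j) (ℓ b)))
  sum-ib-ja : tau G p (S ∪ pair G i b) + tau G p (S ∪ pair G j a) ≡ w + (p (pair G i b) + p (pair G j a))
  sum-ib-ja = trans (tau-∪-pair-+ G p i∉S b∉S j∉S a∉S i≢b j≢a)
    (regroup-links _ (trans (interchange (ℓ i) (ℓ b) (ℓ j) (ℓ a)) (cong ((ℓ i + ℓ j) +_) (comm (ℓ b) (ℓ a)))))
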